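{- For every integer $n\ge1$, $\mathrm{pk}_n(213,312)=\sum_{k=0}^{n-1}\binom{n-1}{k}(k+1)!$.
   Context: For a positive integer $n$, $[n]=\{1,\dots,n\}$. A function $f:[n]\to[n]$ is a parking function if for every $i\in[n]$, $|\{j\in[n]: f(j)\le i\}|\ge i$ (equivalently, in the usual car-parking process where car $i$ prefers spot $f(i)$ and takes the first free spot at or after it, all cars park). The parking permutation $\rho_f\in S_n$ is defined by: spot $i$ is occupied by car $\rho_f(i)$. A permutation $\pi\in S_n$ contains $\sigma\in S_m$ as a pattern if there exist $1\le i_1<\dots<i_m\le n$ with $\pi(i_a)<\pi(i_b)$ iff $\sigma(a)<\sigma(b)$ for all $a,b$; otherwise it avoids $\sigma$. $\mathrm{pk}_n(\sigma_1,\dots,\sigma_k)$ is the number of parking functions $f:[n]\to[n]$ with $\rho_f$ avoiding every $\sigma_i$. -}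

module Defs where

open import Data.Nat using (ℕ; zero; suc; _+_; _*_; _∸_; _<ᵇ_; _≤ᵇ_; _≡ᵇ_)
open import Data.Nat.Combinatorics using (_C_)
open import Data.Nat using (_!)
open import Data.Bool using (Bool; true; false; _∧_; not; if_then_else_)
open import Data.Bool using () renaming (_≟_ to _≟ᵇ_)
open import Data.Fin using (Fin; toℕ)
open import Data.List using (List; []; _∷_; _++_; map; length; filterᵇ; upTo; allFin; zip; concatMap)
open import Data.Bool.ListAction using (all; any)
open import Data.Nat.ListAction using (sum)
open import Data.Maybe using (Maybe; just; nothing; fromMaybe)
open import Data.Product using (_×_; _,_)
open import Relation.Nullary.Decidable using (⌊_⌋)

-- Convention: [n] is represented by Fin n, i.e. the value/spot/car i ∈ [n]
-- is represented by the element with toℕ = i - 1.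
-- A function f : [n] → [n] is a list of length n of elements of Fin n
-- (the j-th entry is f(j)).

allFuns : (m n : ℕ) → List (List (Fin n))
allFuns zero    n = [] ∷ []
allFuns (suc m) n = concatMap (λ x → map (x ∷_) (allFuns m n)) (allFin n)

countLe : {n : ℕ} → ℕ → List (Fin n) → ℕ
countLe i f = length (filterᵇ (λ x → toℕ x ≤ᵇ i) f)

-- Parking function: for every i ∈ [n], |{j : f(j) ≤ i}| ≥ i.
-- (0-indexed: for every i < n, #{j : toℕ f(j) ≤ i} ≥ i + 1.)
isParking : (n : ℕ) → List (Fin n) → Bool
isParking n f = all (λ i → suc i ≤ᵇ countLe i f) (upTo n)

-- The parking process. Spots are a list of Maybe (car label).
-- Car c with preferred spot p takes the first free spot at or after p
-- (and fails to park if there is none).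
occupy : List (Maybe ℕ) → ℕ → ℕ → List (Maybe ℕ)
occupy []              p       c = []
occupy (x ∷ xs)        (suc p) c = x ∷ occupy xs p c
occupy (nothing ∷ xs)  zero    c = just c ∷ xs
occupy (just y ∷ xs)   zero    c = just y ∷ occupy xs zero c

emptySpots : ℕ → List (Maybe ℕ)
emptySpots zero    = []
emptySpots (suc n) = nothing ∷ emptySpots n

-- Cars are processed in order 1, ..., n (labels 0, ..., n-1 here).
parkAll : {n : ℕ} → List (Fin n) → List (Maybe ℕ)
parkAll {n} f = go 0 f (emptySpots n)
  where
  go : ℕ → List (Fin n) → List (Maybe ℕ) → List (Maybe ℕ)
  go c []       s = s
  go c (x ∷ xs) s = go (suc c) xs (occupy s (toℕ x) c)

-- The parking permutation ρ_f in one-line notation: the i-th entry is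
-- the (0-indexed) label of the car in spot i.  For a parking function
-- every spot is occupied, so the default 0 is never used.
parkingPerm : {n : ℕ} → List (Fin n) → List ℕ
parkingPerm f = map (fromMaybe 0) (parkAll f)

subseqs : {A : Set} → ℕ → List A → List (List A)
subseqs zero    xs       = [] ∷ []
subseqs (suc m) []       = []
subseqs (suc m) (x ∷ xs) = map (x ∷_) (subseqs m xs) ++ subseqs (suc m) xs

orderIso : List ℕ → List ℕ → Bool
orderIso xs ys =
  (length xs ≡ᵇ length ys) ∧
  all (λ p → all (λ q → pairOk p q) ps) ps
  where
  ps = zip xs ys
  pairOk : ℕ × ℕ → ℕ × ℕ → Bool
  pairOk (a , b) (c , d) = ⌊ (a <ᵇ c) ≟ᵇ (b <ᵇ d) ⌋

contains : List ℕ → List ℕ → Bool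
contains σ π = any (orderIso σ) (subseqs (length σ) π)

avoidsAll : List (List ℕ) → List ℕ → Bool
avoidsAll σs π = all (λ σ → not (contains σ π)) σs

pk : ℕ → List (List ℕ) → ℕ
pk n σs = length (filterᵇ (λ f → isParking n f ∧ avoidsAll σs (parkingPerm f)) (allFuns n n))

rhs16 : ℕ → ℕ
rhs16 n = sum (map (λ k → ((n ∸ 1) C k) * (suc k) !) (upTo n))

{-# OPTIONS --safe #-}

-- A permutation avoids 213 and 312 iff it has no valley x > y < z, i.e. iff it first increases
-- and then decreases.  Later cars carry larger labels, so a car that
-- parks with free spots on both sides becomes a valley of the final permutation.  Hence in every
-- good history the parked cars form an increasing block of a cars at the left end and a
-- decreasing block at the right end, with g free spots in between (parking functions being the
-- preference lists with which every car parks).  The next car joins the left block if it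
-- prefers one of the first a + 1 spots, joins the right block if it prefers the last free spot,
-- creates a valley if it prefers an inner free spot, and is lost if it prefers a spot of the
-- right block.  So the number gapCount g a of good completions satisfies
-- gapCount g a = (a + 1) gapCount (g - 1) (a + 1) + gapCount (g - 1) a (the second term
-- disappears for g = 1, when the first free spot is also the last), and solving this recurrence
-- gives gapCount g a = ∑ₖ C(g - 1, k) (a + 1)(a + 2)⋯(a + k + 1).  Take a = 0 and g = n.

module Submission where

open import Function using (_∘_; id)
open import Function.Bundles using (Equivalence)
open import Data.Bool using (Bool; T; true; false; not; _∧_)
open import Data.Bool.ListAction using (all)
open import Data.Bool.Properties using (T-∧; T-≡; ∧-zeroʳ)
open import Data.Empty using (⊥; ⊥-elim)
open import Data.Fin using (Fin; toℕ)
import Data.Fin as Fin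
open import Data.Maybe using (Maybe; just; nothing; is-just; fromMaybe)
open import Data.Nat using (ℕ; zero; suc; _+_; _*_; _!; _≤_; _<_; _>_; _≤ᵇ_; _<ᵇ_; _≤?_; z≤n; s≤s; z<s; s<s)
open import Data.Nat.Properties
open import Algebra.Properties.CommutativeSemigroup +-commutativeSemigroup
  using () renaming (interchange to +-interchange; x∙yz≈y∙xz to +-exchange)
open import Algebra.Properties.CommutativeSemigroup *-commutativeSemigroup
  using () renaming (x∙yz≈y∙xz to *-exchange)
open import Data.Nat.Combinatorics using (_C_; nCk+nC[k+1]≡[n+1]C[k+1]; k>n⇒nCk≡0)
open import Data.Nat.ListAction using (sum)
open import Data.List
  using (List; []; _∷_; _++_; map; length; take; zip; filterᵇ; applyUpTo; upTo; allFin; tabulate; concatMap)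
open import Data.List.Properties
  using (length-++; length-map; map-++; map-∘; map-id; ++-assoc; ++-identityʳ; map-tabulate; map-upTo;
         filter-++; filter-≐; filter-accept; filter-reject)
open import Data.List.Membership.Propositional using (_∈_; find; lose)
open import Data.List.Membership.Propositional.Properties using (∈-map⁺; ∈-map⁻; ∈-++⁺ˡ; ∈-++⁺ʳ; ∈-++⁻)
open import Data.List.Relation.Unary.Any using (here; there)
open import Data.List.Relation.Unary.Any.Properties using (any⁺; any⁻)
open import Data.List.Relation.Unary.All as All using (All; []; _∷_)
import Data.List.Relation.Unary.All.Properties as Allₚ
open import Data.List.Relation.Unary.AllPairs using (AllPairs; []; _∷_)
import Data.List.Relation.Unary.AllPairs.Properties as AllPairsₚ
open import Data.List.Relation.Binary.Sublist.Propositional using (_⊆_; []; _∷_; _∷ʳ_; minimum)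
open import Data.List.Relation.Binary.Sublist.Propositional.Properties using (All-resp-⊆)
open import Data.Product using (∃; _,_; proj₂)
open import Data.Sum using (_⊎_; inj₁; inj₂)
open import Relation.Binary using (tri<; tri≈; tri>)
open import Relation.Nullary using (¬_; yes; no)
open import Relation.Nullary.Decidable using (T?; toWitness)
open import Relation.Binary.PropositionalEquality

open import Defs

-- Sums over initial segments of ℕ

infixl 10 ∑<-syntax

∑<-syntax : ℕ → (ℕ → ℕ) → ℕ
∑<-syntax k F = sum (applyUpTo F k)

syntax ∑<-syntax k (λ i → F) = ∑[ i < k ] F

∑-cong : ∀ k {F G : ℕ → ℕ} → (∀ i → i < k → F i ≡ G i) → ∑[ i < k ] F i ≡ ∑[ i < k ] G i
∑-cong zero    eq = refl
∑-cong (suc k) eq = cong₂ _+_ (eq 0 z<s) (∑-cong k (λ i i<k → eq (suc i) (s<s i<k)))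

∑-const : ∀ k {F : ℕ → ℕ} {v} → (∀ i → i < k → F i ≡ v) → ∑[ i < k ] F i ≡ k * v
∑-const zero    eq = refl
∑-const (suc k) eq = cong₂ _+_ (eq 0 z<s) (∑-const k (λ i i<k → eq (suc i) (s<s i<k)))

∑-zero : ∀ k {F : ℕ → ℕ} → (∀ i → i < k → F i ≡ 0) → ∑[ i < k ] F i ≡ 0
∑-zero k eq = trans (∑-const k eq) (*-zeroʳ k)

∑-single : ∀ {k p} {F : ℕ → ℕ} → p < k → (∀ i → i < k → i ≢ p → F i ≡ 0) → ∑[ i < k ] F i ≡ F p
∑-single {suc k} {zero} {F} _ eq0 =
  trans (cong (F 0 +_) (∑-zero k (λ i i<k → eq0 (suc i) (s<s i<k) λ ()))) (+-identityʳ (F 0))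
∑-single {suc k} {suc p} (s<s p<k) eq0 =
  cong₂ _+_ (eq0 0 z<s λ ()) (∑-single p<k (λ i i<k i≢p → eq0 (suc i) (s<s i<k) (i≢p ∘ suc-injective)))

∑-split : ∀ m k {F : ℕ → ℕ} → ∑[ i < m + k ] F i ≡ ∑[ i < m ] F i + ∑[ i < k ] F (m + i)
∑-split zero    k = refl
∑-split (suc m) k {F} = trans (cong (F 0 +_) (∑-split m k)) (sym (+-assoc (F 0) _ _))

∑-last : ∀ k {F : ℕ → ℕ} → ∑[ i < suc k ] F i ≡ ∑[ i < k ] F i + F k
∑-last zero    {F} = +-comm (F 0) 0
∑-last (suc k) {F} = trans (cong (F 0 +_) (∑-last k)) (sym (+-assoc (F 0) _ _))

∑-distrib-+ : ∀ k {F G : ℕ → ℕ} → ∑[ i < k ] (F i + G i) ≡ ∑[ i < k ] F i + ∑[ i < k ] G i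
∑-distrib-+ zero    = refl
∑-distrib-+ (suc k) {F} {G} = trans (cong (F 0 + G 0 +_) (∑-distrib-+ k)) (+-interchange (F 0) (G 0) _ _)

∑-*ˡ : ∀ k v {F : ℕ → ℕ} → ∑[ i < k ] (v * F i) ≡ v * ∑[ i < k ] F i
∑-*ˡ zero    v = sym (*-zeroʳ v)
∑-*ˡ (suc k) v {F} = trans (cong (v * F 0 +_) (∑-*ˡ k v)) (sym (*-distribˡ-+ v (F 0) _))

∑-pascal : ∀ m (h : ℕ → ℕ) →
  ∑[ k < suc (suc m) ] ((suc m C k) * h k) ≡ ∑[ k < suc m ] ((m C k) * h (suc k)) + ∑[ k < suc m ] ((m C k) * h k)
∑-pascal m h = begin
  ∑[ k < suc (suc m) ] ((suc m C k) * h k)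
    ≡⟨⟩
  1 * h 0 + ∑[ k < suc m ] ((suc m C suc k) * h (suc k))
    ≡⟨ cong (1 * h 0 +_) (∑-cong (suc m) λ k _ → pascal k) ⟩
  1 * h 0 + ∑[ k < suc m ] (left k + right k)
    ≡⟨ cong (1 * h 0 +_) (∑-distrib-+ (suc m) {left} {right}) ⟩
  1 * h 0 + (A + ∑[ k < suc m ] right k)
    ≡⟨ cong (λ t → 1 * h 0 + (A + t)) (∑-last m {right}) ⟩
  1 * h 0 + (A + (B + (m C suc m) * h (suc m)))
    ≡⟨ cong (λ t → 1 * h 0 + (A + (B + t * h (suc m)))) (k>n⇒nCk≡0 (n<1+n m)) ⟩
  1 * h 0 + (A + (B + 0))
    ≡⟨ cong (λ t → 1 * h 0 + (A + t)) (+-identityʳ B) ⟩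
  1 * h 0 + (A + B)
    ≡⟨ +-exchange (1 * h 0) A B ⟩
  A + (1 * h 0 + B)
    ≡⟨⟩
  A + ∑[ k < suc m ] ((m C k) * h k) ∎
  where
  open ≡-Reasoning
  left right : ℕ → ℕ
  left  k = (m C k) * h (suc k)
  right k = (m C suc k) * h (suc k)
  A = ∑[ k < suc m ] left k
  B = ∑[ k < m ] right k
  pascal : ∀ k → (suc m C suc k) * h (suc k) ≡ left k + right k
  pascal k = trans (cong (_* h (suc k)) (sym (nCk+nC[k+1]≡[n+1]C[k+1] m k))) (*-distribʳ-+ (h (suc k)) (m C k) _)

-- The recurrence for gapCount and its closed form

rising : ℕ → ℕ → ℕ
rising a zero    = suc a
rising a (suc k) = suc a * rising (suc a) k

rising-* : ∀ a k → rising a k * a ! ≡ suc (a + k) !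
rising-* a zero    = cong (λ t → suc t !) (sym (+-identityʳ a))
rising-* a (suc k) = begin
  suc a * rising (suc a) k * a !   ≡⟨ *-assoc (suc a) (rising (suc a) k) (a !) ⟩
  suc a * (rising (suc a) k * a !) ≡⟨ cong (suc a *_) (*-comm (rising (suc a) k) (a !)) ⟩
  suc a * (a ! * rising (suc a) k) ≡⟨ sym (*-assoc (suc a) (a !) (rising (suc a) k)) ⟩
  suc a ! * rising (suc a) k       ≡⟨ *-comm (suc a !) (rising (suc a) k) ⟩
  rising (suc a) k * suc a !       ≡⟨ rising-* (suc a) k ⟩
  suc (suc a + k) !                ≡⟨ cong (λ t → suc t !) (sym (+-suc a k)) ⟩
  suc (a + suc k) !                ∎
  where open ≡-Reasoning

rising-zero : ∀ k → rising 0 k ≡ suc k !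
rising-zero k = trans (sym (*-identityʳ (rising 0 k))) (rising-* 0 k)

gapCount : ℕ → ℕ → ℕ
gapCount zero          a = 1
gapCount (suc zero)    a = suc a * gapCount zero (suc a)
gapCount (suc (suc g)) a = suc a * gapCount (suc g) (suc a) + gapCount (suc g) a

gapCount-closed : ∀ m a → gapCount (suc m) a ≡ ∑[ k < suc m ] ((m C k) * rising a k)
gapCount-closed zero    a = trans (*-identityʳ (suc a)) (sym (trans (+-identityʳ (1 * suc a)) (*-identityˡ (suc a))))
gapCount-closed (suc m) a = begin
  suc a * gapCount (suc m) (suc a) + gapCount (suc m) a
    ≡⟨ cong₂ (λ u v → suc a * u + v) (gapCount-closed m (suc a)) (gapCount-closed m a) ⟩
  suc a * ∑[ k < suc m ] ((m C k) * rising (suc a) k) + ∑[ k < suc m ] ((m C k) * rising a k)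
    ≡⟨ cong (_+ S) (sym (∑-*ˡ (suc m) (suc a) {λ k → (m C k) * rising (suc a) k})) ⟩
  ∑[ k < suc m ] (suc a * ((m C k) * rising (suc a) k)) + ∑[ k < suc m ] ((m C k) * rising a k)
    ≡⟨ cong (_+ S) (∑-cong (suc m) λ k _ → *-exchange (suc a) (m C k) (rising (suc a) k)) ⟩
  ∑[ k < suc m ] ((m C k) * rising a (suc k)) + ∑[ k < suc m ] ((m C k) * rising a k)
    ≡⟨ sym (∑-pascal m (rising a)) ⟩
  ∑[ k < suc (suc m) ] ((suc m C k) * rising a k) ∎
  where
  open ≡-Reasoning
  S = ∑[ k < suc m ] ((m C k) * rising a k)

-- Counting preference lists

length-filterᵇ-++ : ∀ {A : Set} (p : A → Bool) xs ys →
  length (filterᵇ p (xs ++ ys)) ≡ length (filterᵇ p xs) + length (filterᵇ p ys)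
length-filterᵇ-++ p xs ys = trans (cong length (filter-++ (T? ∘ p) xs ys)) (length-++ (filterᵇ p xs))

length-filterᵇ-map : ∀ {A B : Set} (p : B → Bool) (g : A → B) xs →
  length (filterᵇ p (map g xs)) ≡ length (filterᵇ (p ∘ g) xs)
length-filterᵇ-map p g []       = refl
length-filterᵇ-map p g (x ∷ xs) with p (g x)
... | true  = cong suc (length-filterᵇ-map p g xs)
... | false = length-filterᵇ-map p g xs

length-filterᵇ-concatMap : ∀ {A B : Set} (p : B → Bool) (f : A → List B) xs →
  length (filterᵇ p (concatMap f xs)) ≡ sum (map (length ∘ filterᵇ p ∘ f) xs)
length-filterᵇ-concatMap p f []       = refl
length-filterᵇ-concatMap p f (x ∷ xs) =
  trans (length-filterᵇ-++ p (f x) _) (cong (_ +_) (length-filterᵇ-concatMap p f xs))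

∑-tabulate : ∀ n (G : Fin n → ℕ) {F : ℕ → ℕ} → (∀ x → G x ≡ F (toℕ x)) →
  sum (tabulate G) ≡ ∑[ y < n ] F y
∑-tabulate zero    G eq = refl
∑-tabulate (suc n) G eq = cong₂ _+_ (eq Fin.zero) (∑-tabulate n (G ∘ Fin.suc) (eq ∘ Fin.suc))

module Counting (n : ℕ) where

  count : ℕ → (List (Fin n) → Bool) → ℕ
  count m p = length (filterᵇ p (allFuns m n))

  count-cong : ∀ m {p q : List (Fin n) → Bool} → (∀ r → p r ≡ q r) → count m p ≡ count m q
  count-cong m {p} {q} eq = cong length (filter-≐ (T? ∘ p) (T? ∘ q) (p⊆q , q⊆p) (allFuns m n))
    where
    p⊆q : ∀ {r} → T (p r) → T (q r)
    p⊆q {r} = subst T (eq r)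
    q⊆p : ∀ {r} → T (q r) → T (p r)
    q⊆p {r} = subst T (sym (eq r))

  count-[] : ∀ (p : List (Fin n) → Bool) → p [] ≡ true → count 0 p ≡ 1
  count-[] p eq rewrite eq = refl

  count-suc : ∀ m (p : List (Fin n) → Bool) (F : ℕ → ℕ) →
    (∀ x → count m (p ∘ (x ∷_)) ≡ F (toℕ x)) → count (suc m) p ≡ ∑[ y < n ] F y
  count-suc m p F eq = begin
    length (filterᵇ p (concatMap (λ x → map (x ∷_) (allFuns m n)) (allFin n)))
      ≡⟨ length-filterᵇ-concatMap p _ (allFin n) ⟩
    sum (map (λ x → length (filterᵇ p (map (x ∷_) (allFuns m n)))) (allFin n))
      ≡⟨ cong sum (map-tabulate {n = n} id _) ⟩
    sum (tabulate (λ x → length (filterᵇ p (map (x ∷_) (allFuns m n)))))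
      ≡⟨ ∑-tabulate n _ (λ x → trans (length-filterᵇ-map p (x ∷_) (allFuns m n)) (eq x)) ⟩
    ∑[ y < n ] F y ∎
    where open ≡-Reasoning

  count-none : ∀ m (p : List (Fin n) → Bool) → (∀ r → length r ≡ m → p r ≡ false) → count m p ≡ 0
  count-none zero    p none rewrite none [] refl = refl
  count-none (suc m) p none = trans
    (count-suc m p (λ _ → 0) (λ x → count-none m (p ∘ (x ∷_)) (λ r len → none (x ∷ r) (cong suc len))))
    (∑-zero n (λ _ _ → refl))

-- The parking process

parkFrom : {n : ℕ} → ℕ → List (Fin n) → List (Maybe ℕ) → List (Maybe ℕ)
parkFrom c []      s = s
parkFrom c (x ∷ r) s = parkFrom (suc c) r (occupy s (toℕ x) c)

parkFrom-unique : ∀ {n} (G : ℕ → List (Fin n) → List (Maybe ℕ) → List (Maybe ℕ)) →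
  (∀ c s → G c [] s ≡ s) → (∀ c x r s → G c (x ∷ r) s ≡ G (suc c) r (occupy s (toℕ x) c)) →
  ∀ c r s → G c r s ≡ parkFrom c r s
parkFrom-unique G nil cons c []      s = nil c s
parkFrom-unique G nil cons c (x ∷ r) s = trans (cons c x r s) (parkFrom-unique G nil cons (suc c) r _)

-- parkAll's local loop cannot be named; abstracting over its arguments lets unification pick it as G.
parkAll≡parkFrom : ∀ {n} (f : List (Fin n)) → parkAll f ≡ parkFrom 0 f (emptySpots n)
parkAll≡parkFrom {n} f with parkFrom-unique {n} _ (λ _ _ → refl) (λ _ _ _ _ → refl) | f | emptySpots n | 0
... | unique | r | s | c = unique c r s

-- spot s j is nothing when j is out of range, just nothing when spot j is free.
spot : List (Maybe ℕ) → ℕ → Maybe (Maybe ℕ)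
spot []      _       = nothing
spot (v ∷ _) zero    = just v
spot (_ ∷ s) (suc j) = spot s j

occupied : List (Maybe ℕ) → ℕ
occupied []            = 0
occupied (nothing ∷ s) = occupied s
occupied (just _ ∷ s)  = suc (occupied s)

spot-<-length : ∀ s j {v} → spot s j ≡ just v → j < length s
spot-<-length (_ ∷ s) zero    _  = z<s
spot-<-length (_ ∷ s) (suc j) eq = s<s (spot-<-length s j eq)

length-occupy : ∀ s p c → length (occupy s p c) ≡ length s
length-occupy []            p       c = refl
length-occupy (v ∷ s)       (suc p) c = cong suc (length-occupy s p c)
length-occupy (nothing ∷ s) zero    c = refl
length-occupy (just u ∷ s)  zero    c = cong suc (length-occupy s zero c)

take-occupy : ∀ i s p c → take i (occupy s p c) ≡ occupy (take i s) p c
take-occupy zero    s             p       c = refl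
take-occupy (suc i) []            p       c = refl
take-occupy (suc i) (v ∷ s)       (suc p) c = cong (v ∷_) (take-occupy i s p c)
take-occupy (suc i) (nothing ∷ s) zero    c = refl
take-occupy (suc i) (just u ∷ s)  zero    c = cong (just u ∷_) (take-occupy i s zero c)

take-occupy-beyond : ∀ i s {p} c → i ≤ p → take i (occupy s p c) ≡ take i s
take-occupy-beyond zero    s       c _         = refl
take-occupy-beyond (suc i) []      c _         = refl
take-occupy-beyond (suc i) (v ∷ s) c (s≤s i≤p) = cong (v ∷_) (take-occupy-beyond i s c i≤p)

occupied-occupy : ∀ s p c → occupied (occupy s p c) ≤ suc (occupied s)
occupied-occupy []            p       c = z≤n
occupied-occupy (nothing ∷ s) (suc p) c = occupied-occupy s p c
occupied-occupy (just u ∷ s)  (suc p) c = s≤s (occupied-occupy s p c)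
occupied-occupy (nothing ∷ s) zero    c = ≤-refl
occupied-occupy (just u ∷ s)  zero    c = s≤s (occupied-occupy s zero c)

occupied-take-occupy : ∀ i s {p} c → p ≤ i → spot (occupy s p c) i ≡ just nothing →
  occupied (take i (occupy s p c)) ≡ suc (occupied (take i s))
occupied-take-occupy (suc i) (nothing ∷ s) {suc p} c (s≤s p≤i) free = occupied-take-occupy i s c p≤i free
occupied-take-occupy (suc i) (just u ∷ s)  {suc p} c (s≤s p≤i) free = cong suc (occupied-take-occupy i s c p≤i free)
occupied-take-occupy (suc i) (nothing ∷ s) {zero}  c _         _    = refl
occupied-take-occupy (suc i) (just u ∷ s)  {zero}  c _         free = cong suc (occupied-take-occupy i s c z≤n free)
occupied-take-occupy zero    (nothing ∷ s) {zero}  c _         ()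
occupied-take-occupy zero    (just u ∷ s)  {zero}  c _         ()
occupied-take-occupy i       []                    c _         ()

occupy-keeps : ∀ s j p c {y} → spot s j ≡ just (just y) → spot (occupy s p c) j ≡ just (just y)
occupy-keeps (v ∷ s)       zero    (suc p) c taken = taken
occupy-keeps (v ∷ s)       (suc j) (suc p) c taken = occupy-keeps s j p c taken
occupy-keeps (just u ∷ s)  zero    zero    c taken = taken
occupy-keeps (just u ∷ s)  (suc j) zero    c taken = occupy-keeps s j zero c taken
occupy-keeps (nothing ∷ s) (suc j) zero    c taken = taken

occupy-free : ∀ s j p c → spot s j ≡ just nothing →
  spot (occupy s p c) j ≡ just nothing ⊎ spot (occupy s p c) j ≡ just (just c)
occupy-free (v ∷ s)       zero    (suc p) c free = inj₁ free
occupy-free (v ∷ s)       (suc j) (suc p) c free = occupy-free s j p c free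
occupy-free (nothing ∷ s) zero    zero    c free = inj₂ refl
occupy-free (nothing ∷ s) (suc j) zero    c free = inj₁ free
occupy-free (just u ∷ s)  (suc j) zero    c free = occupy-free s j zero c free

occupy-free⁻ : ∀ s j p c → spot (occupy s p c) j ≡ just nothing → spot s j ≡ just nothing
occupy-free⁻ (v ∷ s)       zero    (suc p) c free = free
occupy-free⁻ (v ∷ s)       (suc j) (suc p) c free = occupy-free⁻ s j p c free
occupy-free⁻ (nothing ∷ s) (suc j) zero    c free = free
occupy-free⁻ (just u ∷ s)  (suc j) zero    c free = occupy-free⁻ s j zero c free
occupy-free⁻ (nothing ∷ s) zero    zero    c ()
occupy-free⁻ (just u ∷ s)  zero    zero    c ()

occupy-parks-once : ∀ s i j p c → spot s i ≡ just nothing → spot s j ≡ just nothing →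
  spot (occupy s p c) i ≡ just (just c) → spot (occupy s p c) j ≡ just (just c) → i ≡ j
occupy-parks-once (v ∷ s)       zero    zero    (suc p) c _ _ _ _ = refl
occupy-parks-once (v ∷ s)       (suc i) (suc j) (suc p) c fi fj pi pj = cong suc (occupy-parks-once s i j p c fi fj pi pj)
occupy-parks-once (v ∷ s)       zero    (suc j) (suc p) c refl _ () _
occupy-parks-once (v ∷ s)       (suc i) zero    (suc p) c _ refl _ ()
occupy-parks-once (nothing ∷ s) zero    zero    zero    c _ _ _ _ = refl
occupy-parks-once (nothing ∷ s) zero    (suc j) zero    c _ fj _ pj with () ← trans (sym fj) pj
occupy-parks-once (nothing ∷ s) (suc i) j       zero    c fi _ pi _ with () ← trans (sym fi) pi
occupy-parks-once (just u ∷ s)  (suc i) (suc j) zero    c fi fj pi pj = cong suc (occupy-parks-once s i j zero c fi fj pi pj)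

countLe-accept : ∀ {n} i {x : Fin n} xs → toℕ x ≤ i → countLe i (x ∷ xs) ≡ suc (countLe i xs)
countLe-accept i {x} xs x≤i = cong length (filter-accept (T? ∘ λ y → toℕ y ≤ᵇ i) {x} {xs} (≤⇒≤ᵇ x≤i))

countLe-reject : ∀ {n} i {x : Fin n} xs → i < toℕ x → countLe i (x ∷ xs) ≡ countLe i xs
countLe-reject i {x} xs i<x =
  cong length (filter-reject (T? ∘ λ y → toℕ y ≤ᵇ i) {x} {xs} (<⇒≱ i<x ∘ ≤ᵇ⇒≤ (toℕ x) i))

module _ {n : ℕ} where

  length-parkFrom : ∀ c (r : List (Fin n)) s → length (parkFrom c r s) ≡ length s
  length-parkFrom c []      s = refl
  length-parkFrom c (x ∷ r) s = trans (length-parkFrom (suc c) r _) (length-occupy s (toℕ x) c)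

  occupied-parkFrom : ∀ c (r : List (Fin n)) s → occupied (parkFrom c r s) ≤ occupied s + length r
  occupied-parkFrom c []      s = ≤-reflexive (sym (+-identityʳ (occupied s)))
  occupied-parkFrom c (x ∷ r) s = begin
    occupied (parkFrom (suc c) r (occupy s (toℕ x) c)) ≤⟨ occupied-parkFrom (suc c) r _ ⟩
    occupied (occupy s (toℕ x) c) + length r          ≤⟨ +-monoˡ-≤ (length r) (occupied-occupy s (toℕ x) c) ⟩
    suc (occupied s) + length r                        ≡⟨ sym (+-suc (occupied s) (length r)) ⟩
    occupied s + suc (length r)                        ∎
    where open ≤-Reasoning

  parkFrom-keeps : ∀ c (r : List (Fin n)) s j {y} → spot s j ≡ just (just y) → spot (parkFrom c r s) j ≡ just (just y)
  parkFrom-keeps c []      s j taken = taken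
  parkFrom-keeps c (x ∷ r) s j taken = parkFrom-keeps (suc c) r _ j (occupy-keeps s j (toℕ x) c taken)

  parkFrom-free⁻ : ∀ c (r : List (Fin n)) s j → spot (parkFrom c r s) j ≡ just nothing → spot s j ≡ just nothing
  parkFrom-free⁻ c []      s j free = free
  parkFrom-free⁻ c (x ∷ r) s j free = occupy-free⁻ s j (toℕ x) c (parkFrom-free⁻ (suc c) r _ j free)

  parkFrom-fresh : ∀ c (r : List (Fin n)) s j {y} → spot s j ≡ just nothing →
    spot (parkFrom c r s) j ≡ just (just y) → c ≤ y
  parkFrom-fresh c []      s j free filled with () ← trans (sym free) filled
  parkFrom-fresh c (x ∷ r) s j free filled with occupy-free s j (toℕ x) c free
  ... | inj₁ free′ = <⇒≤ (parkFrom-fresh (suc c) r _ j free′ filled)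
  ... | inj₂ byC with refl ← trans (sym (parkFrom-keeps (suc c) r _ j byC)) filled = ≤-refl

  parkFrom-distinct : ∀ c (r : List (Fin n)) s i j {y z} → i ≢ j →
    spot s i ≡ just nothing → spot s j ≡ just nothing →
    spot (parkFrom c r s) i ≡ just (just y) → spot (parkFrom c r s) j ≡ just (just z) → y ≢ z
  parkFrom-distinct c []      s i j i≢j fi _ filled _ with () ← trans (sym fi) filled
  parkFrom-distinct c (x ∷ r) s i j i≢j fi fj yi zj
    with occupy-free s i (toℕ x) c fi | occupy-free s j (toℕ x) c fj
  ... | inj₁ fi′ | inj₁ fj′ = parkFrom-distinct (suc c) r _ i j i≢j fi′ fj′ yi zj
  ... | inj₂ ci  | inj₂ cj  = ⊥-elim (i≢j (occupy-parks-once s i j (toℕ x) c fi fj ci cj))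
  ... | inj₂ ci  | inj₁ fj′ with refl ← trans (sym (parkFrom-keeps (suc c) r _ i ci)) yi =
    λ { refl → 1+n≰n (parkFrom-fresh (suc c) r _ j fj′ zj) }
  ... | inj₁ fi′ | inj₂ cj  with refl ← trans (sym (parkFrom-keeps (suc c) r _ j cj)) zj =
    λ { refl → 1+n≰n (parkFrom-fresh (suc c) r _ i fi′ yi) }

  occupied-take-parkFrom-≤ : ∀ i c (r : List (Fin n)) s →
    occupied (take (suc i) (parkFrom c r s)) ≤ occupied (take (suc i) s) + countLe i r
  occupied-take-parkFrom-≤ i c []      s = ≤-reflexive (sym (+-identityʳ _))
  occupied-take-parkFrom-≤ i c (x ∷ r) s with toℕ x ≤? i
  ... | yes x≤i = begin
    occupied (take (suc i) (parkFrom (suc c) r s′))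
      ≤⟨ occupied-take-parkFrom-≤ i (suc c) r s′ ⟩
    occupied (take (suc i) s′) + countLe i r
      ≡⟨ cong (λ t → occupied t + countLe i r) (take-occupy (suc i) s (toℕ x) c) ⟩
    occupied (occupy (take (suc i) s) (toℕ x) c) + countLe i r
      ≤⟨ +-monoˡ-≤ (countLe i r) (occupied-occupy (take (suc i) s) (toℕ x) c) ⟩
    suc (occupied (take (suc i) s)) + countLe i r
      ≡⟨ sym (+-suc _ (countLe i r)) ⟩
    occupied (take (suc i) s) + suc (countLe i r)
      ≡⟨ cong (occupied (take (suc i) s) +_) (sym (countLe-accept i r x≤i)) ⟩
    occupied (take (suc i) s) + countLe i (x ∷ r) ∎
    where
    open ≤-Reasoning
    s′ = occupy s (toℕ x) c
  ... | no x≰i = begin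
    occupied (take (suc i) (parkFrom (suc c) r s′))
      ≤⟨ occupied-take-parkFrom-≤ i (suc c) r s′ ⟩
    occupied (take (suc i) s′) + countLe i r
      ≡⟨ cong (λ t → occupied t + countLe i r) (take-occupy-beyond (suc i) s c (≰⇒> x≰i)) ⟩
    occupied (take (suc i) s) + countLe i r
      ≡⟨ cong (occupied (take (suc i) s) +_) (sym (countLe-reject i r (≰⇒> x≰i))) ⟩
    occupied (take (suc i) s) + countLe i (x ∷ r) ∎
    where
    open ≤-Reasoning
    s′ = occupy s (toℕ x) c

  occupied-take-parkFrom : ∀ i c (r : List (Fin n)) s → spot (parkFrom c r s) i ≡ just nothing →
    occupied (take i (parkFrom c r s)) ≡ occupied (take i s) + countLe i r
  occupied-take-parkFrom i c []      s free = sym (+-identityʳ _)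
  occupied-take-parkFrom i c (x ∷ r) s free with toℕ x ≤? i
  ... | yes x≤i = begin
    occupied (take i (parkFrom (suc c) r s′))
      ≡⟨ occupied-take-parkFrom i (suc c) r s′ free ⟩
    occupied (take i s′) + countLe i r
      ≡⟨ cong (_+ countLe i r) (occupied-take-occupy i s c x≤i (parkFrom-free⁻ (suc c) r s′ i free)) ⟩
    suc (occupied (take i s)) + countLe i r
      ≡⟨ sym (+-suc _ (countLe i r)) ⟩
    occupied (take i s) + suc (countLe i r)
      ≡⟨ cong (occupied (take i s) +_) (sym (countLe-accept i r x≤i)) ⟩
    occupied (take i s) + countLe i (x ∷ r) ∎
    where
    open ≡-Reasoning
    s′ = occupy s (toℕ x) c
  ... | no x≰i = begin
    occupied (take i (parkFrom (suc c) r s′))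
      ≡⟨ occupied-take-parkFrom i (suc c) r s′ free ⟩
    occupied (take i s′) + countLe i r
      ≡⟨ cong (λ t → occupied t + countLe i r) (take-occupy-beyond i s c (<⇒≤ (≰⇒> x≰i))) ⟩
    occupied (take i s) + countLe i r
      ≡⟨ cong (occupied (take i s) +_) (sym (countLe-reject i r (≰⇒> x≰i))) ⟩
    occupied (take i s) + countLe i (x ∷ r) ∎
    where
    open ≡-Reasoning
    s′ = occupy s (toℕ x) c

-- Parking functions are the preference lists with which every car parks

T-ext : ∀ {a b} → (T a → T b) → (T b → T a) → a ≡ b
T-ext {false} {false} _ _ = refl
T-ext {false} {true}  _ f = ⊥-elim (f _)
T-ext {true}  {false} f _ = ⊥-elim (f _)
T-ext {true}  {true}  _ _ = refl

length-emptySpots : ∀ m → length (emptySpots m) ≡ m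
length-emptySpots zero    = refl
length-emptySpots (suc m) = cong suc (length-emptySpots m)

occupied-take-emptySpots : ∀ i m → occupied (take i (emptySpots m)) ≡ 0
occupied-take-emptySpots zero    m       = refl
occupied-take-emptySpots (suc i) zero    = refl
occupied-take-emptySpots (suc i) (suc m) = occupied-take-emptySpots i m

occupied-take-≤ : ∀ i s → occupied (take i s) ≤ i
occupied-take-≤ zero    s             = z≤n
occupied-take-≤ (suc i) []            = z≤n
occupied-take-≤ (suc i) (nothing ∷ s) = m≤n⇒m≤1+n (occupied-take-≤ i s)
occupied-take-≤ (suc i) (just _ ∷ s)  = s≤s (occupied-take-≤ i s)

occupied-take-parked : ∀ i s → T (all is-just s) → i ≤ length s → occupied (take i s) ≡ i
occupied-take-parked zero    s            _      _         = refl
occupied-take-parked (suc i) (just _ ∷ s) parked (s≤s i≤n) = cong suc (occupied-take-parked i s parked i≤n)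

free-spot : ∀ s → T (all is-just s) ⊎ ∃ λ i → spot s i ≡ just nothing
free-spot []            = inj₁ _
free-spot (nothing ∷ s) = inj₂ (0 , refl)
free-spot (just _ ∷ s)  with free-spot s
... | inj₁ parked      = inj₁ parked
... | inj₂ (i , free)  = inj₂ (suc i , free)

isParking≡allParked : ∀ {n} (f : List (Fin n)) → isParking n f ≡ all is-just (parkFrom 0 f (emptySpots n))
isParking≡allParked {n} f = T-ext parking⇒parked parked⇒parking
  where
  t = parkFrom 0 f (emptySpots n)
  length-t : length t ≡ n
  length-t = trans (length-parkFrom 0 f (emptySpots n)) (length-emptySpots n)
  parked⇒bound : T (all is-just t) → ∀ {i} → i < n → suc i ≤ countLe i f
  parked⇒bound parked {i} i<n = begin
    suc i
      ≡⟨ sym (occupied-take-parked (suc i) t parked (≤-trans i<n (≤-reflexive (sym length-t)))) ⟩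
    occupied (take (suc i) t)
      ≤⟨ occupied-take-parkFrom-≤ i 0 f (emptySpots n) ⟩
    occupied (take (suc i) (emptySpots n)) + countLe i f
      ≡⟨ cong (_+ countLe i f) (occupied-take-emptySpots (suc i) n) ⟩
    countLe i f ∎
    where open ≤-Reasoning
  parked⇒parking : T (all is-just t) → T (isParking n f)
  parked⇒parking parked = Allₚ.all⁻ _ (Allₚ.applyUpTo⁺₁ id n λ i<n → ≤⇒≤ᵇ (parked⇒bound parked i<n))
  parking⇒parked : T (isParking n f) → T (all is-just t)
  parking⇒parked parking with free-spot t
  ... | inj₁ parked     = parked
  ... | inj₂ (i , free) = ⊥-elim (<⇒≱ bound countLe≤i)
    where
    i<n : i < n
    i<n = ≤-trans (spot-<-length t i free) (≤-reflexive length-t)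
    bound : suc i ≤ countLe i f
    bound = ≤ᵇ⇒≤ _ _ (Allₚ.applyUpTo⁻ id n (Allₚ.all⁺ _ _ parking) i<n)
    countLe≤i : countLe i f ≤ i
    countLe≤i = begin
      countLe i f                                   ≡⟨ sym (cong (_+ countLe i f) (occupied-take-emptySpots i n)) ⟩
      occupied (take i (emptySpots n)) + countLe i f ≡⟨ sym (occupied-take-parkFrom i 0 f (emptySpots n) free) ⟩
      occupied (take i t)                           ≤⟨ occupied-take-≤ i t ⟩
      i                                             ∎
      where open ≤-Reasoning

-- Valleys and the patterns 213 and 312

∈-subseqs⇒⊆ : ∀ {A : Set} m (xs : List A) {l} → l ∈ subseqs m xs → l ⊆ xs
∈-subseqs⇒⊆ zero    xs       (here refl) = minimum xs
∈-subseqs⇒⊆ (suc m) (x ∷ xs) l∈ with ∈-++⁻ (map (x ∷_) (subseqs m xs)) l∈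
... | inj₁ l∈map with _ , l′∈ , refl ← ∈-map⁻ (x ∷_) l∈map = refl ∷ ∈-subseqs⇒⊆ m xs l′∈
... | inj₂ l∈rest = x ∷ʳ ∈-subseqs⇒⊆ (suc m) xs l∈rest

⊆⇒∈-subseqs : ∀ {A : Set} {l xs : List A} → l ⊆ xs → l ∈ subseqs (length l) xs
⊆⇒∈-subseqs []                     = here refl
⊆⇒∈-subseqs {l = []}    (x ∷ʳ sub) = here refl
⊆⇒∈-subseqs {l = _ ∷ _} (x ∷ʳ sub) = ∈-++⁺ʳ _ (⊆⇒∈-subseqs sub)
⊆⇒∈-subseqs (refl ∷ sub)           = ∈-++⁺ˡ (∈-map⁺ _ (⊆⇒∈-subseqs sub))

⊆-AllPairs : ∀ {A : Set} {R : A → A → Set} {xs ys} → AllPairs R xs → ys ⊆ xs → AllPairs R ys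
⊆-AllPairs []           []           = []
⊆-AllPairs (_ ∷ pairs)  (_ ∷ʳ sub)   = ⊆-AllPairs pairs sub
⊆-AllPairs (px ∷ pairs) (refl ∷ sub) = All-resp-⊆ sub px ∷ ⊆-AllPairs pairs sub

data Valley (π : List ℕ) : Set where
  valley : ∀ {x y z} → (x ∷ y ∷ z ∷ []) ⊆ π → y < x → y < z → Valley π

unimodal-valleyFree : ∀ {L R} → AllPairs _<_ L → AllPairs _>_ R → ¬ Valley (L ++ R)
unimodal-valleyFree {[]} _ dec (valley sub y<x y<z) with _ ∷ (z<y ∷ []) ∷ _ ← ⊆-AllPairs dec sub = <-asym y<z z<y
unimodal-valleyFree {u ∷ L} (_ ∷ inc) dec (valley (_ ∷ʳ sub) y<x y<z) = unimodal-valleyFree inc dec (valley sub y<x y<z)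
unimodal-valleyFree {u ∷ L} {R} (u<L ∷ _) dec (valley {y = y} {z} (refl ∷ sub) y<x y<z) = middle u<L sub
  where
  middle : ∀ {L} → All (u <_) L → (y ∷ z ∷ []) ⊆ L ++ R → ⊥
  middle {[]}    _         sub′        with (z<y ∷ []) ∷ _ ← ⊆-AllPairs dec sub′ = <-asym y<z z<y
  middle {_ ∷ L} (_ ∷ u<L) (_ ∷ʳ sub′) = middle u<L sub′
  middle {_ ∷ L} (u<y ∷ _) (refl ∷ _)  = <-asym y<x u<y

orderIso-agrees : ∀ xs ys {a b c d} → T (orderIso xs ys) →
  (a , b) ∈ zip xs ys → (c , d) ∈ zip xs ys → (a <ᵇ c) ≡ (b <ᵇ d)
orderIso-agrees xs ys iso ab cd =
  toWitness (All.lookup (Allₚ.all⁺ _ _ (All.lookup (Allₚ.all⁺ _ (zip xs ys) (proj₂ (Equivalence.to T-∧ iso))) ab)) cd)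

contains⇒Valley : ∀ {a b c} π → b < a → b < c → T (contains (a ∷ b ∷ c ∷ []) π) → Valley π
contains⇒Valley {a} {b} {c} π b<a b<c hit with l , l∈ , iso ← find (any⁻ _ _ hit) =
  shape l (∈-subseqs⇒⊆ 3 π l∈) iso
  where
  transfer : ∀ {u v x y} → (u <ᵇ v) ≡ (x <ᵇ y) → u < v → x < y
  transfer {x = x} {y} eq u<v = <ᵇ⇒< x y (subst T eq (<⇒<ᵇ u<v))
  σ = a ∷ b ∷ c ∷ []
  shape : ∀ l → l ⊆ π → T (orderIso σ l) → Valley π
  shape (x ∷ y ∷ z ∷ []) sub iso = valley sub
    (transfer (orderIso-agrees σ (x ∷ y ∷ z ∷ []) iso (there (here refl)) (here refl)) b<a)
    (transfer (orderIso-agrees σ (x ∷ y ∷ z ∷ []) iso (there (here refl)) (there (there (here refl)))) b<c)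
  -- orderIso compares lengths first, so only three-element l remain.
  shape []                    _ ()
  shape (_ ∷ [])              _ ()
  shape (_ ∷ _ ∷ [])          _ ()
  shape (_ ∷ _ ∷ _ ∷ _ ∷ _)   _ ()

valleyPatterns : List (List ℕ)
valleyPatterns = (2 ∷ 1 ∷ 3 ∷ []) ∷ (3 ∷ 1 ∷ 2 ∷ []) ∷ []

valleyFree⇒avoids : ∀ {π} → ¬ Valley π → T (avoidsAll valleyPatterns π)
valleyFree⇒avoids {π} free =
  Equivalence.from T-∧ (avoids 1<2 1<3 , Equivalence.from T-∧ (avoids 1<3 1<2 , _))
  where
  1<2 : 1 < 2
  1<2 = s≤s (s≤s z≤n)
  1<3 : 1 < 3
  1<3 = s≤s (s≤s z≤n)
  avoids : ∀ {a b c} → b < a → b < c → T (not (contains (a ∷ b ∷ c ∷ []) π))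
  avoids {a} {b} {c} b<a b<c with contains (a ∷ b ∷ c ∷ []) π in hit
  ... | false = _
  ... | true  = free (contains⇒Valley π b<a b<c (subst T (sym hit) _))

<ᵇ-true : ∀ {m n} → m < n → (m <ᵇ n) ≡ true
<ᵇ-true {zero}  {suc n} _         = refl
<ᵇ-true {suc m} {suc n} (s≤s m<n) = <ᵇ-true m<n

<ᵇ-false : ∀ {m n} → n ≤ m → (m <ᵇ n) ≡ false
<ᵇ-false z≤n       = refl
<ᵇ-false (s≤s n≤m) = <ᵇ-false n≤m

orderIso-213 : ∀ {x y z} → y < x → x < z → T (orderIso (2 ∷ 1 ∷ 3 ∷ []) (x ∷ y ∷ z ∷ []))
orderIso-213 {x} {y} {z} y<x x<z
  rewrite <ᵇ-false (≤-refl {x}) | <ᵇ-false (<⇒≤ y<x) | <ᵇ-true x<z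
        | <ᵇ-true y<x | <ᵇ-false (≤-refl {y}) | <ᵇ-true (<-trans y<x x<z)
        | <ᵇ-false (<⇒≤ x<z) | <ᵇ-false (<⇒≤ (<-trans y<x x<z)) | <ᵇ-false (≤-refl {z}) = _

orderIso-312 : ∀ {x y z} → y < z → z < x → T (orderIso (3 ∷ 1 ∷ 2 ∷ []) (x ∷ y ∷ z ∷ []))
orderIso-312 {x} {y} {z} y<z z<x
  rewrite <ᵇ-false (≤-refl {x}) | <ᵇ-false (<⇒≤ (<-trans y<z z<x)) | <ᵇ-false (<⇒≤ z<x)
        | <ᵇ-true (<-trans y<z z<x) | <ᵇ-false (≤-refl {y}) | <ᵇ-true y<z
        | <ᵇ-true z<x | <ᵇ-false (<⇒≤ y<z) | <ᵇ-false (≤-refl {z}) = _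

⊆⇒contains : ∀ {σ l π} → length l ≡ length σ → l ⊆ π → T (orderIso σ l) → contains σ π ≡ true
⊆⇒contains {l = l} {π} len sub iso =
  Equivalence.to T-≡ (any⁺ _ (lose (subst (λ k → l ∈ subseqs k π) len (⊆⇒∈-subseqs sub)) iso))

valley⇒¬avoids : ∀ {π x y z} → (x ∷ y ∷ z ∷ []) ⊆ π → y < x → y < z → x ≢ z →
  avoidsAll valleyPatterns π ≡ false
valley⇒¬avoids {π} sub y<x y<z x≢z with <-cmp _ _
... | tri< x<z _ _ =
  cong (λ b → not b ∧ (not (contains (3 ∷ 1 ∷ 2 ∷ []) π) ∧ true)) (⊆⇒contains refl sub (orderIso-213 y<x x<z))
... | tri≈ _ x≡z _ = ⊥-elim (x≢z x≡z)
... | tri> _ _ z<x = trans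
  (cong (λ b → not (contains (2 ∷ 1 ∷ 3 ∷ []) π) ∧ (not b ∧ true)) (⊆⇒contains refl sub (orderIso-312 y<z z<x)))
  (∧-zeroʳ _)

-- Good completions of a layout

occupy-skip : ∀ P {m t d c} → length P ≡ m → occupy (P ++ t) (m + d) c ≡ P ++ occupy t d c
occupy-skip []      refl = refl
occupy-skip (v ∷ P) refl = cong (v ∷_) (occupy-skip P refl)

occupy-full : ∀ R {d c} → occupy (map just R) d c ≡ map just R
occupy-full []               = refl
occupy-full (u ∷ R) {zero}   = cong (just u ∷_) (occupy-full R)
occupy-full (u ∷ R) {suc d}  = cong (just u ∷_) (occupy-full R)

occupy-full-suffix : ∀ P R {p c} → length P ≤ p → occupy (P ++ map just R) p c ≡ P ++ map just R
occupy-full-suffix []      R _              = occupy-full R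
occupy-full-suffix (v ∷ P) R {suc p} (s≤s P≤p) = cong (v ∷_) (occupy-full-suffix P R P≤p)

occupy-full-prefix : ∀ L {t y c} → y ≤ length L → occupy (map just L ++ t) y c ≡ map just L ++ occupy t 0 c
occupy-full-prefix []                z≤n       = refl
occupy-full-prefix (u ∷ L) {y = zero}  _         = cong (just u ∷_) (occupy-full-prefix L z≤n)
occupy-full-prefix (u ∷ L) {y = suc y} (s≤s y≤L) = cong (just u ∷_) (occupy-full-prefix L y≤L)

occupy-emptySpots-last : ∀ g {t c} → occupy (emptySpots (suc g) ++ t) g c ≡ emptySpots g ++ just c ∷ t
occupy-emptySpots-last zero    = refl
occupy-emptySpots-last (suc g) = cong (nothing ∷_) (occupy-emptySpots-last g)

occupy-emptySpots-inner : ∀ {i h} t c → i < h →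
  ∃ λ Q → occupy (emptySpots (suc (suc h)) ++ t) (suc i) c ≡ emptySpots i ++ nothing ∷ just c ∷ nothing ∷ Q
occupy-emptySpots-inner {zero}  {suc h} t c _         = emptySpots h ++ t , refl
occupy-emptySpots-inner {suc i} {suc h} t c (s≤s i<h) with Q , eq ← occupy-emptySpots-inner t c i<h =
  Q , cong (nothing ∷_) eq

spot-++ : ∀ P {Q} j → spot (P ++ Q) (j + length P) ≡ spot Q j
spot-++ []      {Q} j = cong (spot Q) (+-identityʳ j)
spot-++ (v ∷ P) {Q} j = trans (cong (spot (v ∷ P ++ Q)) (+-suc j (length P))) (spot-++ P j)

parked-spot : ∀ t j → T (all is-just t) → j < length t → ∃ λ y → spot t j ≡ just (just y)
parked-spot (just y ∷ t) zero    _      _         = y , refl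
parked-spot (just _ ∷ t) (suc j) parked (s≤s j<t) = parked-spot t j parked j<t

spots-⊆ : ∀ t k {u v w} → spot t k ≡ just (just u) → spot t (suc k) ≡ just (just v) →
  spot t (suc (suc k)) ≡ just (just w) → (u ∷ v ∷ w ∷ []) ⊆ map (fromMaybe 0) t
spots-⊆ (_ ∷ t) (suc k) su sv sw = _ ∷ʳ spots-⊆ t k su sv sw
spots-⊆ (just u ∷ just v ∷ just w ∷ t) zero refl refl refl = refl ∷ refl ∷ refl ∷ minimum _

layout : List ℕ → ℕ → List ℕ → List (Maybe ℕ)
layout L g R = map just L ++ emptySpots g ++ map just R

occupied-layout : ∀ L g R → occupied (layout L g R) ≡ length L + length R
occupied-layout (_ ∷ L) g       R       = cong suc (occupied-layout L g R)
occupied-layout []      (suc g) R       = occupied-layout [] g R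
occupied-layout []      zero    (_ ∷ R) = cong suc (occupied-layout [] zero R)
occupied-layout []      zero    []      = refl

length-layout : ∀ L g R → length (layout L g R) ≡ length L + (g + length R)
length-layout (_ ∷ L) g       R       = cong suc (length-layout L g R)
length-layout []      (suc g) R       = cong suc (length-layout [] g R)
length-layout []      zero    (_ ∷ R) = cong suc (length-layout [] zero R)
length-layout []      zero    []      = refl

good : List (Maybe ℕ) → Bool
good s = all is-just s ∧ avoidsAll valleyPatterns (map (fromMaybe 0) s)

all-is-just-map : ∀ (L : List ℕ) t → all is-just (map just L ++ t) ≡ all is-just t
all-is-just-map []      t = refl
all-is-just-map (_ ∷ L) t = all-is-just-map L t

good-unimodal : ∀ {L R} → AllPairs _<_ L → AllPairs _>_ R → good (map just L ++ map just R) ≡ true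
good-unimodal {L} {R} inc dec = cong₂ _∧_ parked avoids
  where
  parked : all is-just (map just L ++ map just R) ≡ true
  parked = trans (all-is-just-map L (map just R))
                 (trans (cong (all is-just) (sym (++-identityʳ (map just R)))) (all-is-just-map R []))
  avoids : avoidsAll valleyPatterns (map (fromMaybe 0) (map just L ++ map just R)) ≡ true
  avoids = begin
    avoidsAll valleyPatterns (map (fromMaybe 0) (map just L ++ map just R))
      ≡⟨ cong (avoidsAll valleyPatterns) (map-++ (fromMaybe 0) (map just L) (map just R)) ⟩
    avoidsAll valleyPatterns (map (fromMaybe 0) (map just L) ++ map (fromMaybe 0) (map just R))
      ≡⟨ cong (avoidsAll valleyPatterns) (cong₂ _++_ (fromMaybe∘just L) (fromMaybe∘just R)) ⟩
    avoidsAll valleyPatterns (L ++ R)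
      ≡⟨ Equivalence.to T-≡ (valleyFree⇒avoids (unimodal-valleyFree inc dec)) ⟩
    true ∎
    where
    open ≡-Reasoning
    fromMaybe∘just : ∀ (xs : List ℕ) → map (fromMaybe 0) (map just xs) ≡ xs
    fromMaybe∘just xs = trans (sym (map-∘ xs)) (map-id xs)

occupied-parked : ∀ t → T (all is-just t) → occupied t ≡ length t
occupied-parked []           _      = refl
occupied-parked (just _ ∷ t) parked = cong suc (occupied-parked t parked)

module Completions (n : ℕ) where
  open Counting n

  completions : ℕ → ℕ → List (Maybe ℕ) → ℕ
  completions c g s = count g (λ r → good (parkFrom c r s))

  completions-overfull : ∀ c g s → occupied s + g < length s → completions c g s ≡ 0
  completions-overfull c g s overfull = count-none g _ unparked
    where
    unparked : ∀ r → length r ≡ g → good (parkFrom c r s) ≡ false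
    unparked r len with all is-just (parkFrom c r s) in parked
    ... | false = refl
    ... | true  = ⊥-elim (<-irrefl refl (begin-strict
      length s                     ≡⟨ sym (length-parkFrom c r s) ⟩
      length (parkFrom c r s)      ≡⟨ sym (occupied-parked (parkFrom c r s) (Equivalence.from T-≡ parked)) ⟩
      occupied (parkFrom c r s)    ≤⟨ occupied-parkFrom c r s ⟩
      occupied s + length r        ≡⟨ cong (occupied s +_) len ⟩
      occupied s + g               <⟨ overfull ⟩
      length s                     ∎))
      where open ≤-Reasoning

  completions-valley : ∀ c g P Q → completions (suc c) g (P ++ nothing ∷ just c ∷ nothing ∷ Q) ≡ 0
  completions-valley c g P Q = count-none g _ λ r _ → valley-unavoidable r
    where
    s = P ++ nothing ∷ just c ∷ nothing ∷ Q
    k = length P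
    valley-unavoidable : ∀ (r : List (Fin n)) → good (parkFrom (suc c) r s) ≡ false
    valley-unavoidable r with all is-just (parkFrom (suc c) r s) in parked
    ... | false = refl
    ... | true  = forced-valley (filled 0 (spot-++ P 0)) (filled 2 (spot-++ P 2))
      where
      t = parkFrom (suc c) r s
      filled : ∀ j {v} → spot s (j + k) ≡ just v → ∃ λ y → spot t (j + k) ≡ just (just y)
      filled j sj = parked-spot t (j + k) (Equivalence.from T-≡ parked)
        (subst (j + k <_) (sym (length-parkFrom (suc c) r s)) (spot-<-length s (j + k) sj))
      forced-valley : (∃ λ y → spot t k ≡ just (just y)) → (∃ λ z → spot t (2 + k) ≡ just (just z)) →
        avoidsAll valleyPatterns (map (fromMaybe 0) t) ≡ false
      forced-valley (y , sy) (z , sz) = valley⇒¬avoids (spots-⊆ t k sy (parkFrom-keeps (suc c) r s (1 + k) (spot-++ P 1)) sz)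
        (parkFrom-fresh (suc c) r s k (spot-++ P 0) sy)
        (parkFrom-fresh (suc c) r s (2 + k) (spot-++ P 2) sz)
        (parkFrom-distinct (suc c) r s k (2 + k) (<⇒≢ (m<n+m k z<s)) (spot-++ P 0) (spot-++ P 2) sy sz)

  record Admissible (c : ℕ) (L : List ℕ) (g : ℕ) (R : List ℕ) : Set where
    field
      fits       : length L + g + length R ≡ n
      increasing : AllPairs _<_ L
      decreasing : AllPairs _>_ R
      L<c        : All (_< c) L
      R<c        : All (_< c) R

  open Admissible

  admissible-left : ∀ {c L g R} → Admissible c L (suc g) R → Admissible (suc c) (L ++ c ∷ []) g R
  admissible-left {c} {L} {g} {R} adm = record
    { fits       = trans (cong (λ k → k + g + length R) (trans (length-++ L) (+-comm (length L) 1)))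
                         (trans (cong (_+ length R) (sym (+-suc (length L) g))) (fits adm))
    ; increasing = AllPairsₚ.++⁺ (increasing adm) (All.[] ∷ []) (All.map (_∷ []) (L<c adm))
    ; decreasing = decreasing adm
    ; L<c        = Allₚ.++⁺ (All.map m<n⇒m<1+n (L<c adm)) (n<1+n c ∷ [])
    ; R<c        = All.map m<n⇒m<1+n (R<c adm)
    }

  admissible-right : ∀ {c L g R} → Admissible c L (suc g) R → Admissible (suc c) L g (c ∷ R)
  admissible-right {c} {L} {g} {R} adm = record
    { fits       = trans (+-suc (length L + g) (length R)) (trans (cong (_+ length R) (sym (+-suc (length L) g))) (fits adm))
    ; increasing = increasing adm
    ; decreasing = R<c adm ∷ decreasing adm
    ; L<c        = All.map m<n⇒m<1+n (L<c adm)
    ; R<c        = n<1+n c ∷ All.map m<n⇒m<1+n (R<c adm)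
    }

  LayoutCount : ℕ → Set
  LayoutCount g = ∀ {c L R} → Admissible c L g R → completions c g (layout L g R) ≡ gapCount g (length L)

  completionsAfter : ℕ → ℕ → List ℕ → List ℕ → ℕ → ℕ
  completionsAfter c g L R y = completions (suc c) g (occupy (layout L (suc g) R) y c)

  completionsAfter-left : ∀ {c g L R y} → LayoutCount g → Admissible c L (suc g) R → y ≤ length L →
    completionsAfter c g L R y ≡ gapCount g (suc (length L))
  completionsAfter-left {c} {g} {L} {R} {y} count adm y≤L = begin
    completions (suc c) g (occupy (layout L (suc g) R) y c)
      ≡⟨ cong (completions (suc c) g) (trans (occupy-full-prefix L y≤L) extend) ⟩
    completions (suc c) g (layout (L ++ c ∷ []) g R)
      ≡⟨ count (admissible-left adm) ⟩
    gapCount g (length (L ++ c ∷ []))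
      ≡⟨ cong (gapCount g) (trans (length-++ L) (+-comm (length L) 1)) ⟩
    gapCount g (suc (length L)) ∎
    where
    open ≡-Reasoning
    extend : map just L ++ just c ∷ emptySpots g ++ map just R ≡ layout (L ++ c ∷ []) g R
    extend = trans (sym (++-assoc (map just L) (just c ∷ []) _)) (cong (_++ _) (sym (map-++ just L (c ∷ []))))

  completionsAfter-right : ∀ {c h L R} → LayoutCount (suc h) → Admissible c L (suc (suc h)) R →
    completionsAfter c (suc h) L R (length L + suc h) ≡ gapCount (suc h) (length L)
  completionsAfter-right {c} {h} {L} {R} count adm = trans
    (cong (completions (suc c) (suc h))
      (trans (occupy-skip (map just L) (length-map just L)) (cong (map just L ++_) (occupy-emptySpots-last (suc h)))))
    (count (admissible-right adm))

  completionsAfter-inner : ∀ {c h L R i} → i < h → completionsAfter c (suc h) L R (length L + suc i) ≡ 0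
  completionsAfter-inner {c} {h} {L} {R} i<h with Q , eq ← occupy-emptySpots-inner (map just R) c i<h = trans
    (cong (completions (suc c) (suc h))
      (trans (occupy-skip (map just L) (length-map just L))
        (trans (cong (map just L ++_) eq) (sym (++-assoc (map just L) _ _)))))
    (completions-valley c (suc h) (map just L ++ emptySpots _) Q)

  completionsAfter-beyond : ∀ {c g L R d} → g < d → completionsAfter c g L R (length L + d) ≡ 0
  completionsAfter-beyond {c} {g} {L} {R} {d} g<d = trans
    (cong (completions (suc c) g) unchanged)
    (completions-overfull (suc c) g (layout L (suc g) R) overfull)
    where
    P = map just L ++ emptySpots (suc g)
    a = length L
    b = length R
    split : layout L (suc g) R ≡ P ++ map just R
    split = sym (++-assoc (map just L) (emptySpots (suc g)) (map just R))
    P≤ : length P ≤ a + d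
    P≤ = ≤-trans (≤-reflexive (trans (length-++ (map just L))
                                     (cong₂ _+_ (length-map just L) (length-emptySpots (suc g)))))
                 (+-monoʳ-≤ a g<d)
    unchanged : occupy (layout L (suc g) R) (a + d) c ≡ layout L (suc g) R
    unchanged = trans (cong (λ s → occupy s (a + d) c) split) (trans (occupy-full-suffix P R P≤) (sym split))
    overfull : occupied (layout L (suc g) R) + g < length (layout L (suc g) R)
    overfull = begin-strict
      occupied (layout L (suc g) R) + g  ≡⟨ cong (_+ g) (occupied-layout L (suc g) R) ⟩
      a + b + g                          ≡⟨ +-assoc a b g ⟩
      a + (b + g)                        ≡⟨ cong (a +_) (+-comm b g) ⟩
      a + (g + b)                        <⟨ n<1+n _ ⟩
      suc (a + (g + b))                  ≡⟨ sym (+-suc a (g + b)) ⟩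
      a + (suc g + b)                    ≡⟨ sym (length-layout L (suc g) R) ⟩
      length (layout L (suc g) R)        ∎
      where open ≤-Reasoning

  ∑-completionsAfter : ∀ {c g L R} → LayoutCount g → Admissible c L (suc g) R →
    ∑[ y < n ] completionsAfter c g L R y ≡
    suc (length L) * gapCount g (suc (length L)) + ∑[ i < g + length R ] completionsAfter c g L R (length L + suc i)
  ∑-completionsAfter {c} {g} {L} {R} count adm = begin
    ∑[ y < n ] F y
      ≡⟨ cong (λ k → ∑[ y < k ] F y) (sym n≡) ⟩
    ∑[ y < suc a + (g + b) ] F y
      ≡⟨ ∑-split (suc a) (g + b) {F} ⟩
    ∑[ y < suc a ] F y + ∑[ i < g + b ] F (suc a + i)
      ≡⟨ cong₂ _+_ (∑-const (suc a) {F} left) (∑-cong (g + b) shift) ⟩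
    suc a * gapCount g (suc a) + ∑[ i < g + b ] F (a + suc i) ∎
    where
    open ≡-Reasoning
    a = length L
    b = length R
    F = completionsAfter c g L R
    n≡ : suc a + (g + b) ≡ n
    n≡ = trans (sym (+-assoc (suc a) g b)) (trans (cong (_+ b) (sym (+-suc a g))) (fits adm))
    left : ∀ y → y < suc a → F y ≡ gapCount g (suc a)
    left y (s≤s y≤a) = completionsAfter-left count adm y≤a
    shift : ∀ i → i < g + b → F (suc a + i) ≡ F (a + suc i)
    shift i _ = cong F (sym (+-suc a i))

  layoutCount : ∀ g → LayoutCount g
  layoutCount zero {c} {L} {R} adm =
    count-[] (λ r → good (parkFrom c r (layout L 0 R))) (good-unimodal (increasing adm) (decreasing adm))
  layoutCount (suc zero) {c} {L} {R} adm = begin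
    completions c 1 (layout L 1 R)
      ≡⟨ count-suc 0 _ F (λ _ → refl) ⟩
    ∑[ y < n ] F y
      ≡⟨ ∑-completionsAfter (layoutCount 0) adm ⟩
    suc a * gapCount 0 (suc a) + ∑[ i < length R ] F (a + suc i)
      ≡⟨ cong (suc a * gapCount 0 (suc a) +_) (∑-zero (length R) {λ i → F (a + suc i)} beyond) ⟩
    suc a * gapCount 0 (suc a) + 0
      ≡⟨ +-identityʳ (suc a * gapCount 0 (suc a)) ⟩
    gapCount 1 a ∎
    where
    open ≡-Reasoning
    a = length L
    F = completionsAfter c 0 L R
    beyond : ∀ i → i < length R → F (a + suc i) ≡ 0
    beyond _ _ = completionsAfter-beyond {c} {0} {L} {R} z<s
  layoutCount (suc (suc h)) {c} {L} {R} adm = begin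
    completions c (suc (suc h)) (layout L (suc (suc h)) R)
      ≡⟨ count-suc (suc h) _ F (λ _ → refl) ⟩
    ∑[ y < n ] F y
      ≡⟨ ∑-completionsAfter (layoutCount (suc h)) adm ⟩
    suc a * gapCount (suc h) (suc a) + ∑[ i < suc h + length R ] F (a + suc i)
      ≡⟨ cong (suc a * gapCount (suc h) (suc a) +_) (∑-single {F = F ∘ (a +_) ∘ suc} (m≤m+n (suc h) (length R)) vanish) ⟩
    suc a * gapCount (suc h) (suc a) + F (a + suc h)
      ≡⟨ cong (suc a * gapCount (suc h) (suc a) +_) (completionsAfter-right (layoutCount (suc h)) adm) ⟩
    gapCount (suc (suc h)) a ∎
    where
    open ≡-Reasoning
    a = length L
    F = completionsAfter c (suc h) L R
    vanish : ∀ i → i < suc h + length R → i ≢ h → F (a + suc i) ≡ 0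
    vanish i _ i≢h with <-cmp i h
    ... | tri< i<h _ _ = completionsAfter-inner i<h
    ... | tri≈ _ i≡h _ = ⊥-elim (i≢h i≡h)
    ... | tri> _ _ h<i = completionsAfter-beyond (s≤s h<i)

  pk≡completions : pk n valleyPatterns ≡ completions 0 n (emptySpots n)
  pk≡completions = count-cong n λ f →
    cong₂ _∧_ (isParking≡allParked f) (cong (avoidsAll valleyPatterns ∘ map (fromMaybe 0)) (parkAll≡parkFrom f))

  empty-admissible : Admissible 0 [] n []
  empty-admissible = record { fits = +-identityʳ n ; increasing = [] ; decreasing = [] ; L<c = [] ; R<c = [] }

mainTheorem16 : (n : ℕ) → 1 ≤ n →
    pk n ((2 ∷ 1 ∷ 3 ∷ []) ∷ (3 ∷ 1 ∷ 2 ∷ []) ∷ []) ≡ rhs16 n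
mainTheorem16 (suc m) _ = begin
  pk (suc m) valleyPatterns
    ≡⟨ pk≡completions ⟩
  completions 0 (suc m) (emptySpots (suc m))
    ≡⟨ cong (completions 0 (suc m)) (sym (++-identityʳ (emptySpots (suc m)))) ⟩
  completions 0 (suc m) (layout [] (suc m) [])
    ≡⟨ layoutCount (suc m) empty-admissible ⟩
  gapCount (suc m) 0
    ≡⟨ gapCount-closed m 0 ⟩
  ∑[ k < suc m ] ((m C k) * rising 0 k)
    ≡⟨ ∑-cong (suc m) (λ k _ → cong ((m C k) *_) (rising-zero k)) ⟩
  ∑[ k < suc m ] ((m C k) * suc k !)
    ≡⟨ cong sum (sym (map-upTo (λ k → (m C k) * suc k !) (suc m))) ⟩
  rhs16 (suc m) ∎
  where
  open ≡-Reasoning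
  open Completions (suc m)
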